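{- Fix a sequence $p_2, p_3, \ldots$ of prime numbers. Let $k \leq d$ and let $H \subset \mathbb{R}^d$ be $(d,k)$-Horton with respect to $p_{k+1},\dots,p_d$. Then for all integers $a$ and $p \geq 1$, the levelled set $H_{a,p}$ is also $(d,k)$-Horton with respect to $p_{k+1},\dots,p_d$.
   Context: A levelled set is a set $L \subset \mathbb{R}^d$ with a surjective affine map $\phi_L : \mathbb{R}^d \to \mathbb{R}$ (level map) such that $\phi_L(L) \subset \mathbb{Z}$. For integers $a$, $p \geq 1$: $L_{a,p} = \{x \in L : \phi_L(x) \equiv a \pmod p\}$ with level map $(\phi_L - a)/p$. $\pi_i$ is the $i$-th coordinate, $\pi_{[k]}$ projection to the first $k$ coordinates. Generic pairs / "deep below": a pair $(S,T)$ of nonempty finite subsets of $\mathbb{R}^d$ with $|S|+|T| = d+1$ is generic if $\pi_{[d-1]}$ is injective on $S$ and on $T$, $\pi_{[d-1]}(S)$ and $\pi_{[d-1]}(T)$ are each affinely independent, and their affine hulls meet in exactly one point; then $S$ lies above $T$ if the unique $s \in \mathrm{aff}(S)$, $t \in \mathrm{aff}(T)$ with $\pi_{[d-1]}(s) = \pi_{[d-1]}(t)$ satisfy $\pi_d(s) > \pi_d(t)$. For finite $A,B$, $B$ lies deep below $A$ if every generic pair $(S,T)$ with $S \subset A$, $T \subset B$ has $S$ above $T$. $(d,k)$-Horton sets: for $k \leq d$, a finite levelled set $H \subset \mathbb{R}^d$ with level map $\phi_H = a\pi_1 + b$ ($a \neq 0$) is $(d,k)$-Horton with respect to $p_{k+1},\dots,p_d$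 if $\pi_{[k]}$ is injective on $H$ and this follows from finitely many applications of: (1) any finite levelled set in $\mathbb{R}^k$ with level map of the form $a\pi_1+b$ is $(k,k)$-Horton; (2) if $|\pi_1(H)| \leq 1$, $H$ is $(d,k)$-Horton; (3) if $d > k$ and (a) $\pi_{[d-1]}(H) \subset \mathbb{R}^{d-1}$, with level map $y \mapsto a\pi_1(y) + b$, is $(d-1,k)$-Horton with respect to $p_{k+1},\dots,p_{d-1}$, (b) each $H_{i,p_d}$, $i = 0,\dots,p_d-1$, is $(d,k)$-Horton with respect to $p_{k+1},\dots,p_d$, and (c) every $I \subset \{0,\dots,p_d-1\}$ with $|I| \geq 2$ can be partitioned into nonempty $J$ and $I \setminus J$ with $\bigcup_{i \in J} H_{i,p_d}$ lying deep below $\bigcup_{i \in I\setminus J} H_{i,p_d}$, then $H$ is $(d,k)$-Horton. -}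

module Defs where

open import Level using (0ℓ)
open import Algebra.Bundles using (CommutativeRing)
open import Relation.Binary.Core using (Rel)
open import Relation.Binary.Structures using (IsStrictTotalOrder)
open import Data.Nat using (ℕ; zero; suc; _≤_) renaming (_+_ to _+ℕ_)
import Data.Nat
import Data.Nat.Properties
open import Data.Integer using (ℤ; +_; -[1+_])
import Data.Integer as ℤ
import Data.Integer.Divisibility as ℤ∣
open import Data.Fin using (Fin; zero; suc; inject₁; fromℕ; inject≤; toℕ)
import Data.Fin.Subset as Sub
open import Data.Product using (Σ; Σ-syntax; ∃; ∃-syntax; _×_; _,_)
open import Data.Sum using (_⊎_)
open import Relation.Nullary using (¬_)
open import Relation.Binary.PropositionalEquality using (_≡_)

-- The multiplicative
-- inverse is a total operation (the value at 0 is irrelevant), only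
-- specified on non-zero elements.

record RealField : Set₁ where
  field
    commutativeRing : CommutativeRing 0ℓ 0ℓ
  open CommutativeRing commutativeRing public
  infix 4 _<_
  field
    _<_                : Rel Carrier 0ℓ
    isStrictTotalOrder : IsStrictTotalOrder _≈_ _<_
    0<1                : 0# < 1#
    +-mono-<           : ∀ {x y} z → x < y → x + z < y + z
    *-pos              : ∀ {x y} → 0# < x → 0# < y → 0# < x * y
    _⁻¹                : Carrier → Carrier
    ⁻¹-cong            : ∀ {x y} → x ≈ y → x ⁻¹ ≈ y ⁻¹
    ⁻¹-inverse         : ∀ x → ¬ (x ≈ 0#) → x * (x ⁻¹) ≈ 1#
  _≤ᵣ_ : Rel Carrier 0ℓ
  x ≤ᵣ y = (x < y) ⊎ (x ≈ y)
  field
    sup : (P : Carrier → Set) → (∃ λ x → P x) →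
          (∃ λ u → ∀ x → P x → x ≤ᵣ u) →
          ∃ λ s → (∀ x → P x → x ≤ᵣ s) × (∀ u → (∀ x → P x → x ≤ᵣ u) → s ≤ᵣ u)

module _ (R : RealField) where
  open RealField R using (Carrier; _≈_; _+_; _*_; -_; _-_; 0#; 1#; _<_; _⁻¹)

  Pt : ℕ → Set
  Pt n = Fin n → Carrier

  _≐_ : ∀ {n} → Pt n → Pt n → Set
  x ≐ y = ∀ i → x i ≈ y i

  PSet : ℕ → Set₁
  PSet n = Pt n → Set

  ιℕ : ℕ → Carrier
  ιℕ zero    = 0#
  ιℕ (suc n) = 1# + ιℕ n

  ι : ℤ → Carrier
  ι (+ n)      = ιℕ n
  ι -[1+ n ]   = - ιℕ (suc n)

  π₁ : ∀ {n} → Pt (suc n) → Carrier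
  π₁ x = x zero

  π[_] : ∀ {m n} → m ≤ n → Pt n → Pt m
  π[ le ] x i = x (inject≤ i le)

  init : ∀ {n} → Pt (suc n) → Pt n
  init x i = x (inject₁ i)

  last : ∀ {n} → Pt (suc n) → Carrier
  last {n} x = x (fromℕ n)

  sumF : ∀ {m} → (Fin m → Carrier) → Carrier
  sumF {zero}  f = 0#
  sumF {suc m} f = f zero + sumF (λ i → f (suc i))

  comb : ∀ {m n} → (Fin m → Carrier) → (Fin m → Pt n) → Pt n
  comb λs S j = sumF (λ i → λs i * S i j)

  Finite : ∀ {n} → PSet n → Set
  Finite {n} H = Σ[ m ∈ ℕ ] Σ[ f ∈ (Fin m → Pt n) ] (∀ x → H x → ∃ λ i → x ≐ f i)

  InjectiveOn : ∀ {n m} → (Pt n → Pt m) → PSet n → Set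
  InjectiveOn f H = ∀ x y → H x → H y → f x ≐ f y → x ≐ y

  Image : ∀ {n m} → (Pt n → Pt m) → PSet n → PSet m
  Image f H y = ∃ λ x → H x × f x ≐ y

  -- Affine notions.  A finite set S of size m is given by an
  -- enumeration  S : Fin m → Pt n.

  -- the enumeration is injective (so the set has exactly m elements)
  IdxInjective : ∀ {m n} → (Fin m → Pt n) → Set
  IdxInjective S = ∀ i j → S i ≐ S j → i ≡ j

  AffinelyIndependent : ∀ {m n} → (Fin m → Pt n) → Set
  AffinelyIndependent S =
    ∀ λs → sumF λs ≈ 0# → (∀ j → comb λs S j ≈ 0#) → ∀ i → λs i ≈ 0#

  InAff : ∀ {m n} → (Fin m → Pt n) → Pt n → Set
  InAff S y = ∃ λ λs → sumF λs ≈ 1# × comb λs S ≐ y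

  MeetInExactlyOnePoint : ∀ {m m' n} → (Fin m → Pt n) → (Fin m' → Pt n) → Set
  MeetInExactlyOnePoint S T =
    (∃ λ y → InAff S y × InAff T y) ×
    (∀ y z → InAff S y → InAff T y → InAff S z → InAff T z → y ≐ z)

  Generic : ∀ {m m' n} → (Fin m → Pt (suc n)) → (Fin m' → Pt (suc n)) → Set
  Generic {m} {m'} {n} S T =
    1 ≤ m × 1 ≤ m' × m +ℕ m' ≡ suc (suc n) ×
    IdxInjective (λ i → init (S i)) × IdxInjective (λ i → init (T i)) ×
    AffinelyIndependent (λ i → init (S i)) ×
    AffinelyIndependent (λ i → init (T i)) ×
    MeetInExactlyOnePoint (λ i → init (S i)) (λ i → init (T i))

  -- S lies above T: for the (unique) s ∈ aff S, t ∈ aff T with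
  -- π_[n](s) = π_[n](t) we have π_(n+1)(s) > π_(n+1)(t)
  Above : ∀ {m m' n} → (Fin m → Pt (suc n)) → (Fin m' → Pt (suc n)) → Set
  Above S T = ∀ λs μs → sumF λs ≈ 1# → sumF μs ≈ 1# →
              init (comb λs S) ≐ init (comb μs T) →
              last (comb μs T) < last (comb λs S)

  DeepBelow : ∀ {n} → PSet (suc n) → PSet (suc n) → Set
  DeepBelow {n} B A =
    ∀ m m' (S : Fin m → Pt (suc n)) (T : Fin m' → Pt (suc n)) →
    (∀ i → A (S i)) → (∀ j → B (T j)) → Generic S T → Above S T

  lev : ∀ {n} → Carrier → Carrier → Pt (suc n) → Carrier
  lev a b x = a * π₁ x + b

  -- H is a levelled set with level map a π₁ + b (a ≠ 0, i.e. surjective)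
  Levelled : ∀ {n} → Carrier → Carrier → PSet (suc n) → Set
  Levelled a b H = ¬ (a ≈ 0#) × (∀ x → H x → ∃ λ z → lev a b x ≈ ι z)

  Sublevel : ∀ {n} → Carrier → Carrier → ℤ → ℕ → PSet (suc n) → PSet (suc n)
  Sublevel a b c p H x =
    H x × ∃ λ z → lev a b x ≈ ι z × (+ p) ℤ∣.∣ (z ℤ.- c)

  -- level map of L_{c,p} is (φ_L - c)/p = (a/p) π₁ + (b - c)/p
  subA : Carrier → ℕ → Carrier
  subA a p = a * (ι (+ p)) ⁻¹

  subB : Carrier → ℤ → ℕ → Carrier
  subB b c p = (b - ι c) * (ι (+ p)) ⁻¹

  -- Dimensions are written as  suc k  and  suc d  (both ≥ 1, needed for π₁):
  --   HortonSet p k d a b H  means  H ⊂ R^(suc d) is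
  --   (suc d, suc k)-Horton w.r.t. p_(k+2),...,p_(suc d), level map a π₁ + b.

  record HortonBase {d} (k : ℕ) (k≤d : k ≤ d) (a b : Carrier)
                    (H : PSet (suc d)) : Set where
    field
      finite    : Finite H
      levelled  : Levelled a b H
      injective : InjectiveOn π[ Data.Nat.s≤s k≤d ] H

  ⋃Sub : ∀ {n q} → Carrier → Carrier → PSet (suc n) → Sub.Subset q → PSet (suc n)
  ⋃Sub {q = q} a b H J x = ∃ λ (i : Fin q) → i Sub.∈ J × Sublevel a b (+ toℕ i) q H x

  data HortonSet (p : ℕ → ℕ) (k : ℕ) :
       (d : ℕ) → Carrier → Carrier → PSet (suc d) → Set₁ where
    rule1 : ∀ {a b H} (k≤k : k ≤ k) → HortonBase k k≤k a b H →
            HortonSet p k k a b H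
    rule2 : ∀ {d a b H} (k≤d : k ≤ d) → HortonBase k k≤d a b H →
            (∀ x y → H x → H y → π₁ x ≈ π₁ y) →
            HortonSet p k d a b H
    -- rule (3), in dimension suc (suc d) > suc k, with p_(suc (suc d))
    rule3 : ∀ {d a b H} (k≤d : k ≤ d) →
            HortonBase k (Data.Nat.Properties.m≤n⇒m≤1+n k≤d) a b H →
            HortonSet p k d a b (Image init H) →
            (∀ (i : Fin (p (suc (suc d)))) →
               HortonSet p k (suc d)
                 (subA a (p (suc (suc d))))
                 (subB b (+ toℕ i) (p (suc (suc d))))
                 (Sublevel a b (+ toℕ i) (p (suc (suc d))) H)) →
            (∀ (I : Sub.Subset (p (suc (suc d)))) → 2 ≤ Sub.∣ I ∣ →
               ∃ λ J → J Sub.⊆ I × Sub.Nonempty J × Sub.Nonempty (I Sub.─ J) ×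
                 DeepBelow (⋃Sub a b H J) (⋃Sub a b H (I Sub.─ J))) →
            HortonSet p k (suc d) a b H

-- Finiteness, injectivity of π_[k] and
-- constancy of π₁ pass to subsets, and L_{c,q} is levelled by (φ_L − c)/q.  In rule (3), with
-- P = p_d, projection commutes with taking sublevels, and the classes of L_{c,q} modulo P are
-- sublevels of classes of L: since c + q i = j + P w, we have (L_{c,q})_{i,P} = (L_{j,P})_{w,q},
-- which is Horton by induction.  For the deep-below partitions: if P ∤ q, then i ↦ c + q i is
-- injective modulo P, so every class of L_{c,q} lies in a distinct class of L, and a partition
-- of the image of I pulls back to I.  If P ∣ q, then L_{c,q} is a sublevel of the single class
-- L_{c mod P, P}, hence Horton by induction, and being Horton in dimension > k already provides
-- the partitions (vacuously under rule (2), where at most one class is nonempty).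
module Submission where

open import Defs
open import Data.Nat using (ℕ; _≤_; suc)
open import Data.Nat.Primality using (Prime)
open import Data.Integer using (ℤ)

import Algebra.Bundles
import Algebra.Solver.Ring
open import Algebra.Solver.Ring.AlmostCommutativeRing using (fromCommutativeRing; _-Raw-AlmostCommutative⟶_)
open import Data.Empty using (⊥-elim)
open import Data.Fin as Fin using (Fin; zero; suc; toℕ)
open import Data.Fin.Properties using (toℕ<n; toℕ-injective; toℕ-fromℕ<; suc-injective; any?)
import Data.Fin.Subset as Sub
open import Data.Fin.Subset using (Subset; inside; outside; _∈_; _∉_; _─_; _∩_; ⁅_⁆; ∣_∣; Nonempty)
open import Data.Fin.Subset.Properties
  using ( _∈?_; x∈⁅x⁆; x∈⁅y⁆⇒x≡y; ∣⁅x⁆∣≡1; p⊆q⇒∣p∣≤∣q∣; x∈p∧x≢y⇒x∈p-y; x∈p⇒∣p-x∣<∣p∣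
        ; x∈p∧x∉q⇒x∈p─q; p─q⊆p; p∩q⊆p; x∈p∩q⁺; x∈p∩q⁻ )
open import Data.Integer as ℤ using (+_; _⊖_)
import Data.Integer.DivMod as ℤ
import Data.Integer.Properties as ℤ
import Data.Integer.Divisibility.Signed as ℤs
open import Data.Integer.Tactic.RingSolver using (solve-∀)
open import Data.Maybe using (Maybe; just; nothing)
import Data.Nat as ℕ
import Data.Nat.Divisibility as ℕ
import Data.Nat.Properties as ℕ
open import Data.Nat.Primality using (euclidsLemma; prime⇒nonZero)
import Data.Product as Product
open import Data.Product using (∃; ∃₂; _×_; _,_; proj₁; proj₂)
open import Data.Sum using (inj₁; inj₂)
open import Data.Vec using (tabulate; here; there; _∷_)
open import Data.Vec.Properties using (lookup∘tabulate; []=⇒lookup; lookup⇒[]=)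
open import Function using (_∘_)
open import Relation.Binary.PropositionalEquality as ≡ using (_≡_; _≢_; cong; cong₂; subst)
open import Relation.Binary.Structures using (IsStrictTotalOrder)
open import Relation.Nullary using (¬_; does; yes; no)
open import Relation.Nullary.Decidable using (dec-true; _×-dec_)
open import Relation.Unary using (Pred; Decidable; _⊆′_)
open import Relation.Unary.Properties using (⊆′-trans)

∈⇒1≤∣p∣ : ∀ {n} {x : Fin n} {p : Subset n} → x ∈ p → 1 ≤ ∣ p ∣
∈⇒1≤∣p∣ {x = x} {p} x∈p = subst (_≤ ∣ p ∣) (∣⁅x⁆∣≡1 x) (p⊆q⇒∣p∣≤∣q∣ ⁅x⁆⊆p)
  where
  ⁅x⁆⊆p : ∀ {y} → y ∈ ⁅ x ⁆ → y ∈ p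
  ⁅x⁆⊆p y∈⁅x⁆ = subst (_∈ p) (≡.sym (x∈⁅y⁆⇒x≡y x y∈⁅x⁆)) x∈p

∈∧∈∧≢⇒2≤∣p∣ : ∀ {n} {x y : Fin n} {p : Subset n} → x ∈ p → y ∈ p → x ≢ y → 2 ≤ ∣ p ∣
∈∧∈∧≢⇒2≤∣p∣ x∈p y∈p x≢y =
  ℕ.≤-trans (ℕ.s≤s (∈⇒1≤∣p∣ (x∈p∧x≢y⇒x∈p-y y∈p (x≢y ∘ ≡.sym)))) (x∈p⇒∣p-x∣<∣p∣ x∈p)

1≤∣p∣⇒Nonempty : ∀ {n} (p : Subset n) → 1 ≤ ∣ p ∣ → Nonempty p
1≤∣p∣⇒Nonempty (inside ∷ p)  _     = zero , here
1≤∣p∣⇒Nonempty (outside ∷ p) 1≤∣p∣ = Product.map suc there (1≤∣p∣⇒Nonempty p 1≤∣p∣)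

2≤∣p∣⇒∈∧∈∧≢ : ∀ {n} (p : Subset n) → 2 ≤ ∣ p ∣ → ∃₂ λ x y → x ∈ p × y ∈ p × x ≢ y
2≤∣p∣⇒∈∧∈∧≢ (inside ∷ p) (ℕ.s≤s 1≤∣p∣) =
  let y , y∈p = 1≤∣p∣⇒Nonempty p 1≤∣p∣ in zero , suc y , here , there y∈p , λ ()
2≤∣p∣⇒∈∧∈∧≢ (outside ∷ p) 2≤∣p∣ =
  let x , y , x∈p , y∈p , x≢y = 2≤∣p∣⇒∈∧∈∧≢ p 2≤∣p∣
  in suc x , suc y , there x∈p , there y∈p , x≢y ∘ suc-injective

x∈p─q⇒x∉q : ∀ {n} {x : Fin n} (p q : Subset n) → x ∈ p ─ q → x ∉ q
x∈p─q⇒x∉q (_ ∷ p) (outside ∷ q) here       ()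
x∈p─q⇒x∉q (_ ∷ p) (inside ∷ q)  (there x∈) (there x∈q) = x∈p─q⇒x∉q p q x∈ x∈q
x∈p─q⇒x∉q (_ ∷ p) (outside ∷ q) (there x∈) (there x∈q) = x∈p─q⇒x∉q p q x∈ x∈q

filter : ∀ {ℓ n} {P : Pred (Fin n) ℓ} → Decidable P → Subset n
filter P? = tabulate (does ∘ P?)

module _ {ℓ n} {P : Pred (Fin n) ℓ} (P? : Decidable P) where

  ∈-filter⁺ : ∀ {x} → P x → x ∈ filter P?
  ∈-filter⁺ {x} Px = lookup⇒[]= x _ (≡.trans (lookup∘tabulate _ x) (dec-true (P? x) Px))

  ∈-filter⁻ : ∀ {x} → x ∈ filter P? → P x
  ∈-filter⁻ {x} x∈ with P? x | ≡.trans (≡.sym (lookup∘tabulate _ x)) ([]=⇒lookup x∈)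
  ... | yes Px | _  = Px
  ... | no _   | ()

module _ {q r} (t : Fin q → Fin r) (I : Subset q) where

  private
    hit? : Decidable (λ j → ∃ λ i → i ∈ I × t i ≡ j)
    hit? j = any? λ i → (i ∈? I) ×-dec (t i Fin.≟ j)

  image : Subset r
  image = filter hit?

  ∈-image⁺ : ∀ {i} → i ∈ I → t i ∈ image
  ∈-image⁺ {i} i∈I = ∈-filter⁺ hit? (i , i∈I , ≡.refl)

  ∈-image⁻ : ∀ {j} → j ∈ image → ∃ λ i → i ∈ I × t i ≡ j
  ∈-image⁻ = ∈-filter⁻ hit?

preimage : ∀ {q r} → (Fin q → Fin r) → Subset r → Subset q
preimage t J = filter (λ i → t i ∈? J)

residues-distinct : ∀ {m} (i j : Fin m) → m ℕ.∣ ℤ.∣ + toℕ i ℤ.- + toℕ j ∣ → i ≡ j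
residues-distinct {m} i j m∣i-j =
  toℕ-injective (ℤ.+-injective (ℤ.i-j≡0⇒i≡j _ _ (ℤ.∣i∣≡0⇒i≡0 (multiple<m⇒≡0 ∣i-j∣<m m∣i-j))))
  where
  ∣i-j∣<m : ℤ.∣ + toℕ i ℤ.- + toℕ j ∣ ℕ.< m
  ∣i-j∣<m = subst (λ z → ℤ.∣ z ∣ ℕ.< m) (≡.sym (ℤ.m-n≡m⊖n (toℕ i) (toℕ j)))
              (ℕ.≤-<-trans (ℤ.∣m⊝n∣≤m⊔n (toℕ i) (toℕ j)) (ℕ.⊔-pres-<m (toℕ<n i) (toℕ<n j)))
  multiple<m⇒≡0 : ∀ {n} → n ℕ.< m → m ℕ.∣ n → n ≡ 0
  multiple<m⇒≡0 {ℕ.zero}  _   _   = ≡.refl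
  multiple<m⇒≡0 {ℕ.suc _} n<m m∣n = ⊥-elim (ℕ.>⇒∤ n<m m∣n)

residue : ℤ → ∀ m .{{_ : ℕ.NonZero m}} → Fin m
residue e m = Fin.fromℕ< (ℤ.n%ℕd<d e m)

residue-quotient : ∀ e m .{{_ : ℕ.NonZero m}} → e ≡ + toℕ (residue e m) ℤ.+ + m ℤ.* (e ℤ./ℕ m)
residue-quotient e m = ≡.trans (ℤ.a≡a%ℕn+[a/ℕn]*n e m)
  (cong₂ (λ r w → + r ℤ.+ w) (≡.sym (toℕ-fromℕ< (ℤ.n%ℕd<d e m))) (ℤ.*-comm (e ℤ./ℕ m) (+ m)))

module _ where
  open ≡.≡-Reasoning
  open import Data.Integer using (_+_; _-_; _*_)

  sub-∘ : ∀ z c c′ m n {w v} → z - c ≡ w * m → w - c′ ≡ v * n → z - (c + m * c′) ≡ v * (m * n)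
  sub-∘ z c c′ m n {w} {v} z-c≡wm w-c′≡vn = begin
    z - (c + m * c′) ≡⟨ split z c c′ m ⟩
    (z - c) - m * c′ ≡⟨ cong (_- m * c′) z-c≡wm ⟩
    w * m - m * c′   ≡⟨ factor w c′ m ⟩
    (w - c′) * m     ≡⟨ cong (_* m) w-c′≡vn ⟩
    v * n * m        ≡⟨ reorder v n m ⟩
    v * (m * n)      ∎
    where
    split : ∀ z c c′ m → z - (c + m * c′) ≡ (z - c) - m * c′
    split = solve-∀
    factor : ∀ w c′ m → w * m - m * c′ ≡ (w - c′) * m
    factor = solve-∀
    reorder : ∀ v n m → v * n * m ≡ v * (m * n)
    reorder = solve-∀

  sub-∘⁻¹ : ∀ z c c′ m n {v} → z - (c + m * c′) ≡ v * (m * n) → z - c ≡ (c′ + v * n) * m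
  sub-∘⁻¹ z c c′ m n {v} eq = begin
    z - c                       ≡⟨ unsplit z c c′ m ⟩
    (z - (c + m * c′)) + m * c′ ≡⟨ cong (_+ m * c′) eq ⟩
    v * (m * n) + m * c′        ≡⟨ factor v c′ m n ⟩
    (c′ + v * n) * m            ∎
    where
    unsplit : ∀ z c c′ m → z - c ≡ (z - (c + m * c′)) + m * c′
    unsplit = solve-∀
    factor : ∀ v c′ m n → v * (m * n) + m * c′ ≡ (c′ + v * n) * m
    factor = solve-∀

  affine-residues-injective : ∀ {P q} → Prime P → ¬ P ℕ.∣ q → ∀ {c w w′} {r : Fin P} (i i′ : Fin P) →
    c + + q * + toℕ i ≡ + toℕ r + + P * w → c + + q * + toℕ i′ ≡ + toℕ r + + P * w′ → i ≡ i′
  affine-residues-injective {P} {q} P-prime P∤q {c} {w} {w′} {r} i i′ eq eq′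
    with euclidsLemma q ℤ.∣ + toℕ i - + toℕ i′ ∣ P-prime P∣q[i-i′]
    where
    difference : ∀ c q i i′ → q * (i - i′) ≡ (c + q * i) - (c + q * i′)
    difference = solve-∀
    cancel : ∀ r P w w′ → (r + P * w) - (r + P * w′) ≡ (w - w′) * P
    cancel = solve-∀
    q[i-i′]≡[w-w′]P : + q * (+ toℕ i - + toℕ i′) ≡ (w - w′) * + P
    q[i-i′]≡[w-w′]P = begin
      + q * (+ toℕ i - + toℕ i′)                  ≡⟨ difference c (+ q) (+ toℕ i) (+ toℕ i′) ⟩
      (c + + q * + toℕ i) - (c + + q * + toℕ i′)  ≡⟨ cong₂ _-_ eq eq′ ⟩
      (+ toℕ r + + P * w) - (+ toℕ r + + P * w′)  ≡⟨ cancel (+ toℕ r) (+ P) w w′ ⟩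
      (w - w′) * + P                              ∎
    P∣q[i-i′] : P ℕ.∣ q ℕ.* ℤ.∣ + toℕ i - + toℕ i′ ∣
    P∣q[i-i′] = subst (P ℕ.∣_) (ℤ.abs-* (+ q) _) (ℤs.∣⇒∣ᵤ (ℤs.divides (w - w′) q[i-i′]≡[w-w′]P))
  ... | inj₁ P∣q    = ⊥-elim (P∤q P∣q)
  ... | inj₂ P∣i-i′ = residues-distinct i i′ P∣i-i′

module _ (R : RealField) where
  open RealField R hiding (zero)
  open import Algebra.Properties.Ring ring using (-‿involutive; -0#≈0#; -‿distribˡ-*; -‿distribʳ-*; -‿+-comm)
  open import Relation.Binary.Reasoning.Setoid setoid
  open IsStrictTotalOrder isStrictTotalOrder using (irrefl; <-resp-≈) renaming (trans to <-trans)

  ιℕ-+ : ∀ m n → ιℕ R (m ℕ.+ n) ≈ ιℕ R m + ιℕ R n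
  ιℕ-+ ℕ.zero    n = sym (+-identityˡ _)
  ιℕ-+ (ℕ.suc m) n = trans (+-congˡ (ιℕ-+ m n)) (sym (+-assoc _ _ _))

  ιℕ-* : ∀ m n → ιℕ R (m ℕ.* n) ≈ ιℕ R m * ιℕ R n
  ιℕ-* ℕ.zero    n = sym (zeroˡ _)
  ιℕ-* (ℕ.suc m) n = begin
    ιℕ R (n ℕ.+ m ℕ.* n)          ≈⟨ ιℕ-+ n (m ℕ.* n) ⟩
    ιℕ R n + ιℕ R (m ℕ.* n)       ≈⟨ +-cong (sym (*-identityˡ _)) (ιℕ-* m n) ⟩
    1# * ιℕ R n + ιℕ R m * ιℕ R n ≈⟨ sym (distribʳ _ _ _) ⟩
    (1# + ιℕ R m) * ιℕ R n        ∎

  ι-⊖ : ∀ m n → ι R (m ⊖ n) ≈ ιℕ R m - ιℕ R n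
  ι-⊖ ℕ.zero    ℕ.zero    = sym (-‿inverseʳ 0#)
  ι-⊖ ℕ.zero    (ℕ.suc n) = sym (+-identityˡ _)
  ι-⊖ (ℕ.suc m) ℕ.zero    = sym (trans (+-congˡ -0#≈0#) (+-identityʳ _))
  ι-⊖ (ℕ.suc m) (ℕ.suc n) = begin
    ι R (ℕ.suc m ⊖ ℕ.suc n)           ≡⟨ cong (ι R) (ℤ.[1+m]⊖[1+n]≡m⊖n m n) ⟩
    ι R (m ⊖ n)                       ≈⟨ ι-⊖ m n ⟩
    M - N                             ≈⟨ +-congˡ (sym (+-identityˡ _)) ⟩
    M + (0# - N)                      ≈⟨ +-congˡ (+-congʳ (sym (-‿inverseʳ 1#))) ⟩
    M + ((1# - 1#) - N)               ≈⟨ +-congˡ (+-assoc _ _ _) ⟩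
    M + (1# + (- 1# - N))             ≈⟨ sym (+-assoc _ _ _) ⟩
    (M + 1#) + (- 1# - N)             ≈⟨ +-cong (+-comm _ _) (-‿+-comm _ _) ⟩
    (1# + M) - (1# + N)               ∎
    where
    M = ιℕ R m
    N = ιℕ R n

  ι-‿homo : ∀ i → ι R (ℤ.- i) ≈ - ι R i
  ι-‿homo (+ ℕ.zero)  = sym -0#≈0#
  ι-‿homo (+ ℕ.suc n) = refl
  ι-‿homo ℤ.-[1+ n ]  = sym (-‿involutive _)

  ι-+ : ∀ i j → ι R (i ℤ.+ j) ≈ ι R i + ι R j
  ι-+ ℤ.-[1+ m ] ℤ.-[1+ n ] = begin
    - ιℕ R (ℕ.suc (ℕ.suc (m ℕ.+ n)))  ≡⟨ cong (λ k → - ιℕ R (ℕ.suc k)) (≡.sym (ℕ.+-suc m n)) ⟩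
    - ιℕ R (ℕ.suc m ℕ.+ ℕ.suc n)      ≈⟨ -‿cong (ιℕ-+ (ℕ.suc m) (ℕ.suc n)) ⟩
    - (ιℕ R (ℕ.suc m) + ιℕ R (ℕ.suc n)) ≈⟨ sym (-‿+-comm _ _) ⟩
    - ιℕ R (ℕ.suc m) + - ιℕ R (ℕ.suc n) ∎
  ι-+ ℤ.-[1+ m ] (+ n)     = trans (ι-⊖ n (ℕ.suc m)) (+-comm _ _)
  ι-+ (+ m)     ℤ.-[1+ n ] = ι-⊖ m (ℕ.suc n)
  ι-+ (+ m)     (+ n)      = ιℕ-+ m n

  ι-- : ∀ i j → ι R (i ℤ.- j) ≈ ι R i - ι R j
  ι-- i j = trans (ι-+ i (ℤ.- j)) (+-congˡ (ι-‿homo j))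

  ι-+* : ∀ m j → ι R (+ m ℤ.* j) ≈ ιℕ R m * ι R j
  ι-+* m (+ n) = trans (reflexive (cong (ι R) (≡.sym (ℤ.pos-* m n)))) (ιℕ-* m n)
  ι-+* m ℤ.-[1+ n ] = begin
    ι R (+ m ℤ.* ℤ.- + ℕ.suc n)       ≡⟨ cong (ι R) (≡.sym (ℤ.neg-distribʳ-* (+ m) (+ ℕ.suc n))) ⟩
    ι R (ℤ.- (+ m ℤ.* + ℕ.suc n))     ≈⟨ ι-‿homo (+ m ℤ.* + ℕ.suc n) ⟩
    - ι R (+ m ℤ.* + ℕ.suc n)         ≈⟨ -‿cong (ι-+* m (+ ℕ.suc n)) ⟩
    - (ιℕ R m * ιℕ R (ℕ.suc n))       ≈⟨ -‿distribʳ-* _ _ ⟩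
    ιℕ R m * - ιℕ R (ℕ.suc n)         ∎

  ι-* : ∀ i j → ι R (i ℤ.* j) ≈ ι R i * ι R j
  ι-* (+ m)     j = ι-+* m j
  ι-* ℤ.-[1+ m ] j = begin
    ι R (ℤ.- + ℕ.suc m ℤ.* j)         ≡⟨ cong (ι R) (≡.sym (ℤ.neg-distribˡ-* (+ ℕ.suc m) j)) ⟩
    ι R (ℤ.- (+ ℕ.suc m ℤ.* j))       ≈⟨ ι-‿homo (+ ℕ.suc m ℤ.* j) ⟩
    - ι R (+ ℕ.suc m ℤ.* j)           ≈⟨ -‿cong (ι-+* (ℕ.suc m) j) ⟩
    - (ιℕ R (ℕ.suc m) * ι R j)        ≈⟨ -‿distribˡ-* _ _ ⟩
    - ιℕ R (ℕ.suc m) * ι R j          ∎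

  0<ιℕ[1+n] : ∀ n → 0# < ιℕ R (ℕ.suc n)
  0<ιℕ[1+n] ℕ.zero    = proj₁ <-resp-≈ (sym (+-identityʳ 1#)) 0<1
  0<ιℕ[1+n] (ℕ.suc n) =
    <-trans (0<ιℕ[1+n] n) (proj₂ <-resp-≈ (+-identityˡ _) (+-mono-< (ιℕ R (ℕ.suc n)) 0<1))

  ιℕ[1+n]≉0 : ∀ n → ¬ (ιℕ R (ℕ.suc n) ≈ 0#)
  ιℕ[1+n]≉0 n eq = irrefl (sym eq) (0<ιℕ[1+n] n)

  ι≈0⇒≡0 : ∀ i → ι R i ≈ 0# → i ≡ ℤ.0ℤ
  ι≈0⇒≡0 (+ ℕ.zero)  _  = ≡.refl
  ι≈0⇒≡0 (+ ℕ.suc n) eq = ⊥-elim (ιℕ[1+n]≉0 n eq)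
  ι≈0⇒≡0 ℤ.-[1+ n ]  eq = ⊥-elim (ιℕ[1+n]≉0 n (trans (sym (-‿involutive _)) (trans (-‿cong eq) -0#≈0#)))

  ι-injective : ∀ i j → ι R i ≈ ι R j → i ≡ j
  ι-injective i j eq = ℤ.i-j≡0⇒i≡j i j (ι≈0⇒≡0 _ (trans (ι-- i j) (trans (+-congʳ eq) (-‿inverseʳ _))))

  private
    ι-homomorphism : Algebra.Bundles.CommutativeRing.rawRing ℤ.+-*-commutativeRing
                       -Raw-AlmostCommutative⟶ fromCommutativeRing commutativeRing
    ι-homomorphism = record
      { ⟦_⟧ = ι R ; +-homo = ι-+ ; *-homo = ι-* ; -‿homo = ι-‿homo ; 0-homo = refl
      ; 1-homo = +-identityʳ 1# }

    ι-≟ : ∀ i j → Maybe (ι R i ≈ ι R j)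
    ι-≟ i j with i ℤ.≟ j
    ... | yes ≡.refl = just refl
    ... | no _       = nothing

  open Algebra.Solver.Ring _ _ ι-homomorphism ι-≟ using (solve; _:+_; _:*_; _:-_; _:=_)

  1/_ : ℕ → Carrier
  1/ q = ι R (+ q) ⁻¹


  ι[q]≉0 : ∀ {q} → 1 ≤ q → ¬ (ι R (+ q) ≈ 0#)
  ι[q]≉0 {ℕ.suc q} _ = ιℕ[1+n]≉0 q

  ι[q]*1/q≈1 : ∀ {q} → 1 ≤ q → ι R (+ q) * 1/ q ≈ 1#
  ι[q]*1/q≈1 1≤q = ⁻¹-inverse _ (ι[q]≉0 1≤q)

  ⁻¹-unique : ∀ x y → ¬ (x ≈ 0#) → x * y ≈ 1# → y ≈ x ⁻¹
  ⁻¹-unique x y x≉0 xy≈1 = begin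
    y                ≈⟨ sym (*-identityʳ y) ⟩
    y * 1#           ≈⟨ *-congˡ (sym (⁻¹-inverse x x≉0)) ⟩
    y * (x * x ⁻¹)   ≈⟨ sym (*-assoc _ _ _) ⟩
    (y * x) * x ⁻¹   ≈⟨ *-congʳ (trans (*-comm y x) xy≈1) ⟩
    1# * x ⁻¹        ≈⟨ *-identityˡ _ ⟩
    x ⁻¹             ∎

  1/-* : ∀ {m n} → 1 ≤ m → 1 ≤ n → 1/ (m ℕ.* n) ≈ 1/ m * 1/ n
  1/-* {m} {n} 1≤m 1≤n = sym (⁻¹-unique _ _ (ι[q]≉0 (ℕ.*-mono-≤ 1≤m 1≤n)) (begin
    ι R (+ (m ℕ.* n)) * (1/ m * 1/ n)
      ≈⟨ *-congʳ (ιℕ-* m n) ⟩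
    (ι R (+ m) * ι R (+ n)) * (1/ m * 1/ n)
      ≈⟨ solve 4 (λ a b c d → (a :* b) :* (c :* d) := (a :* c) :* (b :* d)) refl _ _ _ _ ⟩
    (ι R (+ m) * 1/ m) * (ι R (+ n) * 1/ n)
      ≈⟨ *-cong (ι[q]*1/q≈1 1≤m) (ι[q]*1/q≈1 1≤n) ⟩
    1# * 1#
      ≈⟨ *-identityʳ _ ⟩
    1# ∎))

  subA-≉0 : ∀ {a q} → 1 ≤ q → ¬ (a ≈ 0#) → ¬ (subA R a q ≈ 0#)
  subA-≉0 {a} {q} 1≤q a≉0 a/q≈0 = a≉0 (begin
    a                      ≈⟨ sym (*-identityʳ a) ⟩
    a * 1#                 ≈⟨ *-congˡ (sym (trans (*-comm _ _) (ι[q]*1/q≈1 1≤q))) ⟩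
    a * (1/ q * ι R (+ q)) ≈⟨ sym (*-assoc _ _ _) ⟩
    subA R a q * ι R (+ q) ≈⟨ *-congʳ a/q≈0 ⟩
    0# * ι R (+ q)         ≈⟨ zeroˡ _ ⟩
    0#                     ∎)

  subA-∘ : ∀ a {m n} → 1 ≤ m → 1 ≤ n → subA R (subA R a m) n ≈ subA R a (m ℕ.* n)
  subA-∘ a 1≤m 1≤n = trans (*-assoc _ _ _) (*-congˡ (sym (1/-* 1≤m 1≤n)))

  subB-∘ : ∀ b c c′ {m n} → 1 ≤ m → 1 ≤ n →
           subB R (subB R b c m) c′ n ≈ subB R b (c ℤ.+ + m ℤ.* c′) (m ℕ.* n)
  subB-∘ b c c′ {m} {n} 1≤m 1≤n = sym (begin
    (b - ι R (c ℤ.+ + m ℤ.* c′)) * 1/ (m ℕ.* n)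
      ≈⟨ *-cong (+-congˡ (-‿cong (trans (ι-+ c _) (+-congˡ (ι-* (+ m) c′))))) (1/-* 1≤m 1≤n) ⟩
    (b - (ι R c + ι R (+ m) * ι R c′)) * (1/ m * 1/ n)
      ≈⟨ solve 6 (λ b c M c′ U V → (b :- (c :+ M :* c′)) :* (U :* V) := ((b :- c) :* U :- c′ :* (M :* U)) :* V)
                 refl _ _ _ _ _ _ ⟩
    ((b - ι R c) * 1/ m - ι R c′ * (ι R (+ m) * 1/ m)) * 1/ n
      ≈⟨ *-congʳ (+-congˡ (-‿cong (trans (*-congˡ (ι[q]*1/q≈1 1≤m)) (*-identityʳ _)))) ⟩
    ((b - ι R c) * 1/ m - ι R c′) * 1/ n ∎)

  lev-Sublevel : ∀ {n a b} c q (x : Pt R (suc n)) →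
                 lev R (subA R a q) (subB R b c q) x ≈ (lev R a b x - ι R c) * 1/ q
  lev-Sublevel {a = a} {b} c q x =
    solve 5 (λ a u x b c → a :* u :* x :+ (b :- c) :* u := (a :* x :+ b :- c) :* u)
            refl a (1/ q) (π₁ R x) b (ι R c)

  lev-Sublevel-ι : ∀ {n a b} c {q} (x : Pt R (suc n)) {z w} → 1 ≤ q →
                   lev R a b x ≈ ι R z → z ℤ.- c ≡ w ℤ.* + q →
                   lev R (subA R a q) (subB R b c q) x ≈ ι R w
  lev-Sublevel-ι {a = a} {b} c {q} x {z} {w} 1≤q lev≈z z-c≡wq = begin
    lev R (subA R a q) (subB R b c q) x ≈⟨ lev-Sublevel c q x ⟩
    (lev R a b x - ι R c) * 1/ q        ≈⟨ *-congʳ (trans (+-congʳ lev≈z) (sym (ι-- z c))) ⟩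
    ι R (z ℤ.- c) * 1/ q                ≡⟨ cong (λ t → ι R t * 1/ q) z-c≡wq ⟩
    ι R (w ℤ.* + q) * 1/ q              ≈⟨ *-congʳ (ι-* w (+ q)) ⟩
    (ι R w * ι R (+ q)) * 1/ q          ≈⟨ *-assoc _ _ _ ⟩
    ι R w * (ι R (+ q) * 1/ q)          ≈⟨ *-congˡ (ι[q]*1/q≈1 1≤q) ⟩
    ι R w * 1#                          ≈⟨ *-identityʳ _ ⟩
    ι R w                               ∎

  record LevelledSet (d : ℕ) : Set₁ where
    constructor levelledSet
    field
      slope offset : Carrier
      points       : PSet R (suc d)

  open LevelledSet

  infixl 9 _[_mod_]
  infix 4 _⊑_ _≋_

  _[_mod_] : ∀ {d} → LevelledSet d → ℤ → ℕ → LevelledSet d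
  L [ c mod q ] =
    levelledSet (subA R (slope L) q) (subB R (offset L) c q) (Sublevel R (slope L) (offset L) c q (points L))

  project : ∀ {d} → LevelledSet (suc d) → LevelledSet d
  project L = levelledSet (slope L) (offset L) (Image R (init R) (points L))

  ⋃[_] : ∀ {d q} → LevelledSet d → Subset q → PSet R (suc d)
  ⋃[ L ] J = ⋃Sub R (slope L) (offset L) (points L) J

  Base : ∀ {d} k → k ≤ d → LevelledSet d → Set
  Base k k≤d L = HortonBase R k k≤d (slope L) (offset L) (points L)

  Horton : (ℕ → ℕ) → ℕ → ∀ {d} → LevelledSet d → Set₁
  Horton p k {d} L = HortonSet R p k d (slope L) (offset L) (points L)

  Splittable : ∀ {d} → ℕ → LevelledSet d → Set
  Splittable q L = ∀ (I : Subset q) → 2 ≤ ∣ I ∣ →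
    ∃ λ J → J Sub.⊆ I × Nonempty J × Nonempty (I ─ J) × DeepBelow R (⋃[ L ] J) (⋃[ L ] (I ─ J))

  _⊑_ : ∀ {d} → LevelledSet d → LevelledSet d → Set
  L ⊑ L′ = slope L ≈ slope L′ × offset L ≈ offset L′ × points L ⊆′ points L′

  _≋_ : ∀ {d} → LevelledSet d → LevelledSet d → Set
  L ≋ L′ = L ⊑ L′ × L′ ⊑ L

  ⊑-trans : ∀ {d} {L L′ L″ : LevelledSet d} → L ⊑ L′ → L′ ⊑ L″ → L ⊑ L″
  ⊑-trans (a≈ , b≈ , H⊆) (a≈′ , b≈′ , H⊆′) = trans a≈ a≈′ , trans b≈ b≈′ , ⊆′-trans H⊆ H⊆′

  ⊑-refl : ∀ {d} {L : LevelledSet d} → L ⊑ L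
  ⊑-refl = refl , refl , λ _ x∈H → x∈H

  ⊑⇒⊆ : ∀ {d} {L L′ : LevelledSet d} → L ⊑ L′ → points L ⊆′ points L′
  ⊑⇒⊆ = proj₂ ∘ proj₂

  ≋-trans : ∀ {d} {L L′ L″ : LevelledSet d} → L ≋ L′ → L′ ≋ L″ → L ≋ L″
  ≋-trans (L⊑L′ , L′⊑L) (L′⊑L″ , L″⊑L′) = ⊑-trans L⊑L′ L′⊑L″ , ⊑-trans L″⊑L′ L′⊑L

  ≋-sym : ∀ {d} {L L′ : LevelledSet d} → L ≋ L′ → L′ ≋ L
  ≋-sym (L⊑L′ , L′⊑L) = L′⊑L , L⊑L′

  lev-cong : ∀ {d} {L L′ : LevelledSet d} → L ⊑ L′ → ∀ (x : Pt R (suc d)) →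
             lev R (slope L′) (offset L′) x ≈ lev R (slope L) (offset L) x
  lev-cong (a≈ , b≈ , _) x = sym (+-cong (*-congʳ a≈) b≈)

  [mod]-mono : ∀ {d} {L L′ : LevelledSet d} c q → L ⊑ L′ → L [ c mod q ] ⊑ L′ [ c mod q ]
  [mod]-mono c q L⊑L′@(a≈ , b≈ , H⊆) =
    *-congʳ a≈ , *-congʳ (+-congʳ b≈) ,
    λ { x (x∈H , z , lev≈z , q∣z-c) → H⊆ x x∈H , z , trans (lev-cong L⊑L′ x) lev≈z , q∣z-c }

  project-mono : ∀ {d} {L L′ : LevelledSet (suc d)} → L ⊑ L′ → project L ⊑ project L′
  project-mono (a≈ , b≈ , H⊆) = a≈ , b≈ , λ { y (x , x∈H , x↦y) → x , H⊆ x x∈H , x↦y }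

  ⋃-mono : ∀ {d q} {L L′ : LevelledSet d} (J : Subset q) → L ⊑ L′ → ⋃[ L ] J ⊆′ ⋃[ L′ ] J
  ⋃-mono J L⊑L′ x (i , i∈J , x∈Lᵢ) = i , i∈J , ⊑⇒⊆ ([mod]-mono (+ toℕ i) _ L⊑L′) x x∈Lᵢ

  DeepBelow-anti : ∀ {d} {A A′ B B′ : PSet R (suc d)} → B′ ⊆′ B → A′ ⊆′ A → DeepBelow R B A → DeepBelow R B′ A′
  DeepBelow-anti B′⊆B A′⊆A below m m′ S T S⊆A′ T⊆B′ =
    below m m′ S T (λ i → A′⊆A _ (S⊆A′ i)) (λ j → B′⊆B _ (T⊆B′ j))

  Splittable-anti : ∀ {d q} {L L′ : LevelledSet d} → L ⊑ L′ → Splittable q L′ → Splittable q L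
  Splittable-anti L⊑L′ split I 2≤∣I∣ =
    let J , J⊆I , J≢∅ , I─J≢∅ , below = split I 2≤∣I∣
    in J , J⊆I , J≢∅ , I─J≢∅ , DeepBelow-anti (⋃-mono J L⊑L′) (⋃-mono (I ─ J) L⊑L′) below

  Base-anti : ∀ {d k} {k≤d : k ≤ d} {L L′ : LevelledSet d} → L ⊑ L′ → Base k k≤d L′ → Base k k≤d L
  Base-anti L⊑L′@(a≈ , b≈ , H⊆) base = record
    { finite    = let m , f , f-onto = finite in m , f , λ x x∈H → f-onto x (H⊆ x x∈H)
    ; levelled  = (λ a≈0 → proj₁ levelled (trans (sym a≈) a≈0)) ,
                  (λ x x∈H → let z , lev≈z = proj₂ levelled x (H⊆ x x∈H)
                             in z , trans (sym (lev-cong L⊑L′ x)) lev≈z)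
    ; injective = λ x y x∈H y∈H → injective x y (H⊆ x x∈H) (H⊆ y y∈H)
    }
    where open HortonBase base

  Horton-resp : ∀ {p k d} {L L′ : LevelledSet d} → L ≋ L′ → Horton p k L → Horton p k L′
  Horton-resp (_ , L′⊑L) (rule1 k≤k base) = rule1 k≤k (Base-anti L′⊑L base)
  Horton-resp (_ , L′⊑L@(_ , _ , H⊆)) (rule2 k≤d base π₁-const) =
    rule2 k≤d (Base-anti L′⊑L base) (λ x y x∈H y∈H → π₁-const x y (H⊆ x x∈H) (H⊆ y y∈H))
  Horton-resp (L⊑L′ , L′⊑L) (rule3 k≤d base proj-H sub-H split) =
    rule3 k≤d (Base-anti L′⊑L base)
      (Horton-resp (project-mono L⊑L′ , project-mono L′⊑L) proj-H)
      (λ i → Horton-resp ([mod]-mono _ _ L⊑L′ , [mod]-mono _ _ L′⊑L) (sub-H i))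
      (Splittable-anti L′⊑L split)

  [mod]-cong : ∀ {d} {L : LevelledSet d} {c c′ q q′} → c ≡ c′ → q ≡ q′ → L [ c mod q ] ≋ L [ c′ mod q′ ]
  [mod]-cong ≡.refl ≡.refl = ⊑-refl , ⊑-refl

  [mod]-∘-⊆ : ∀ {d} (L : LevelledSet d) c c′ {m n} → 1 ≤ m →
              points (L [ c mod m ] [ c′ mod n ]) ⊆′ points (L [ c ℤ.+ + m ℤ.* c′ mod m ℕ.* n ])
  [mod]-∘-⊆ L c c′ {m} {n} 1≤m x ((x∈H , z , lev≈z , m∣z-c) , z′ , lev′≈z′ , n∣z′-c′)
    with ℤs.∣ᵤ⇒∣ {+ m} m∣z-c | ℤs.∣ᵤ⇒∣ {+ n} n∣z′-c′
  ... | ℤs.divides w z-c≡wm | ℤs.divides v z′-c′≡vn =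
    x∈H , z , lev≈z ,
    ℤs.∣⇒∣ᵤ {+ (m ℕ.* n)} (ℤs.divides v (≡.trans (sub-∘ z c c′ (+ m) (+ n) {w} {v} z-c≡wm w-c′≡vn) mn≡))
    where
    w≡z′ : w ≡ z′
    w≡z′ = ι-injective w z′ (trans (sym (lev-Sublevel-ι c x {z} {w} 1≤m lev≈z z-c≡wm)) lev′≈z′)
    w-c′≡vn : w ℤ.- c′ ≡ v ℤ.* + n
    w-c′≡vn = subst (λ t → t ℤ.- c′ ≡ v ℤ.* + n) (≡.sym w≡z′) z′-c′≡vn
    mn≡ : v ℤ.* (+ m ℤ.* + n) ≡ v ℤ.* + (m ℕ.* n)
    mn≡ = cong (v ℤ.*_) (≡.sym (ℤ.pos-* m n))

  [mod]-∘-⊇ : ∀ {d} (L : LevelledSet d) c c′ {m n} → 1 ≤ m →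
              points (L [ c ℤ.+ + m ℤ.* c′ mod m ℕ.* n ]) ⊆′ points (L [ c mod m ] [ c′ mod n ])
  [mod]-∘-⊇ L c c′ {m} {n} 1≤m x (x∈H , z , lev≈z , mn∣z-c″) with ℤs.∣ᵤ⇒∣ {+ (m ℕ.* n)} mn∣z-c″
  ... | ℤs.divides v z-c″≡vmn =
    (x∈H , z , lev≈z , ℤs.∣⇒∣ᵤ {+ m} (ℤs.divides w z-c≡wm)) ,
    w , lev-Sublevel-ι c x {z} {w} 1≤m lev≈z z-c≡wm ,
    ℤs.∣⇒∣ᵤ {+ n} (ℤs.divides v (cancel c′ (v ℤ.* + n)))
    where
    w = c′ ℤ.+ v ℤ.* + n
    z-c≡wm : z ℤ.- c ≡ w ℤ.* + m
    z-c≡wm = sub-∘⁻¹ z c c′ (+ m) (+ n) {v} (≡.trans z-c″≡vmn (cong (v ℤ.*_) (ℤ.pos-* m n)))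
    cancel : ∀ c t → c ℤ.+ t ℤ.- c ≡ t
    cancel = solve-∀

  [mod]-∘ : ∀ {d} (L : LevelledSet d) c c′ {m n} → 1 ≤ m → 1 ≤ n →
            L [ c mod m ] [ c′ mod n ] ≋ L [ c ℤ.+ + m ℤ.* c′ mod m ℕ.* n ]
  [mod]-∘ L c c′ 1≤m 1≤n =
    (subA-∘ (slope L) 1≤m 1≤n , subB-∘ (offset L) c c′ 1≤m 1≤n , [mod]-∘-⊆ L c c′ 1≤m) ,
    (sym (subA-∘ (slope L) 1≤m 1≤n) , sym (subB-∘ (offset L) c c′ 1≤m 1≤n) , [mod]-∘-⊇ L c c′ 1≤m)

  [mod]-⊆ : ∀ {d} (L : LevelledSet d) {c m n w} → m ℕ.∣ n →
            points (L [ c ℤ.+ + m ℤ.* w mod n ]) ⊆′ points (L [ c mod m ])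
  [mod]-⊆ L {c} {m} {n} {w} m∣n x (x∈H , z , lev≈z , n∣z-c-mw) =
    x∈H , z , lev≈z , ℤs.∣⇒∣ᵤ {+ m} (subst (+ m ℤs.∣_) (regroup z c (+ m) w) (ℤs.∣m∣n⇒∣m+n m∣z-c-mw m∣mw))
    where
    m∣z-c-mw : + m ℤs.∣ z ℤ.- (c ℤ.+ + m ℤ.* w)
    m∣z-c-mw = ℤs.∣-trans (ℤs.∣ᵤ⇒∣ {+ m} {+ n} m∣n) (ℤs.∣ᵤ⇒∣ {+ n} n∣z-c-mw)
    m∣mw : + m ℤs.∣ + m ℤ.* w
    m∣mw = ℤs.∣m⇒∣m*n w ℤs.∣-refl
    regroup : ∀ z c m w → z ℤ.- (c ℤ.+ m ℤ.* w) ℤ.+ m ℤ.* w ≡ z ℤ.- c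
    regroup = solve-∀

  project-[mod] : ∀ {d} (L : LevelledSet (suc d)) c q → project (L [ c mod q ]) ≋ project L [ c mod q ]
  project-[mod] L c q = (refl , refl , ⊆) , (refl , refl , ⊇)
    where
    lev-init : ∀ {x y} → (∀ i → init R x i ≈ y i) →
               lev R (slope L) (offset L) y ≈ lev R (slope L) (offset L) x
    lev-init x↦y = +-congʳ (*-congˡ (sym (x↦y zero)))
    ⊆ : points (project (L [ c mod q ])) ⊆′ points (project L [ c mod q ])
    ⊆ y (x , (x∈H , z , lev≈z , q∣) , x↦y) = (x , x∈H , x↦y) , z , trans (lev-init {x} x↦y) lev≈z , q∣
    ⊇ : points (project L [ c mod q ]) ⊆′ points (project (L [ c mod q ]))
    ⊇ y ((x , x∈H , x↦y) , z , lev≈z , q∣) = x , (x∈H , z , trans (sym (lev-init {x} x↦y)) lev≈z , q∣) , x↦y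

  Base-[mod] : ∀ {d k} {k≤d : k ≤ d} {L : LevelledSet d} c {q} → 1 ≤ q →
               Base k k≤d L → Base k k≤d (L [ c mod q ])
  Base-[mod] {L = L} c {q} 1≤q base = record
    { finite    = let m , f , f-onto = finite in m , f , λ x x∈ → f-onto x (proj₁ x∈)
    ; levelled  = subA-≉0 1≤q (proj₁ levelled) , λ x x∈ → level x x∈
    ; injective = λ x y x∈ y∈ → injective x y (proj₁ x∈) (proj₁ y∈)
    }
    where
    open HortonBase base
    level : ∀ x → points (L [ c mod q ]) x →
            ∃ λ w → lev R (slope (L [ c mod q ])) (offset (L [ c mod q ])) x ≈ ι R w
    level x (_ , z , lev≈z , q∣z-c) with ℤs.∣ᵤ⇒∣ {+ q} {z ℤ.- c} q∣z-c
    ... | ℤs.divides w z-c≡wq = w , lev-Sublevel-ι c x {z} {w} 1≤q lev≈z z-c≡wq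

  residue-unique : ∀ {d} (L : LevelledSet d) {q} (i j : Fin q) {x y} → π₁ R x ≈ π₁ R y →
                   points (L [ + toℕ i mod q ]) x → points (L [ + toℕ j mod q ]) y → i ≡ j
  residue-unique L {q} i j {x} π₁x≈π₁y (_ , z , lev≈z , q∣z-i) (_ , z′ , lev≈z′ , q∣z′-j) =
    residues-distinct i j (ℤs.∣⇒∣ᵤ {+ q} (subst (+ q ℤs.∣_) (cancel z (+ toℕ i) (+ toℕ j))
      (ℤs.∣m∣n⇒∣m-n (ℤs.∣ᵤ⇒∣ {+ q} {z ℤ.- + toℕ j} q∣z-j) (ℤs.∣ᵤ⇒∣ {+ q} {z ℤ.- + toℕ i} q∣z-i))))
    where
    z≡z′ : z ≡ z′
    z≡z′ = ι-injective z z′ (trans (sym lev≈z) (trans (+-congʳ (*-congˡ π₁x≈π₁y)) lev≈z′))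
    q∣z-j : ℤ.∣ + q ∣ ℕ.∣ ℤ.∣ z ℤ.- + toℕ j ∣
    q∣z-j = subst (λ t → ℤ.∣ + q ∣ ℕ.∣ ℤ.∣ t ℤ.- + toℕ j ∣) (≡.sym z≡z′) q∣z′-j
    cancel : ∀ z i j → (z ℤ.- j) ℤ.- (z ℤ.- i) ≡ i ℤ.- j
    cancel = solve-∀

  π₁-constant⇒Splittable : ∀ {d q} (L : LevelledSet d) →
                           (∀ x y → points L x → points L y → π₁ R x ≈ π₁ R y) → Splittable q L
  π₁-constant⇒Splittable L π₁-const I 2≤∣I∣ with 2≤∣p∣⇒∈∧∈∧≢ I 2≤∣I∣
  ... | i , j , i∈I , j∈I , i≢j =
    ⁅ i ⁆ , ⁅i⁆⊆I , (i , x∈⁅x⁆ i) , (j , x∈p∧x∉q⇒x∈p─q j∈I (i≢j ∘ ≡.sym ∘ x∈⁅y⁆⇒x≡y i)) , vacuous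
    where
    ⁅i⁆⊆I : ⁅ i ⁆ Sub.⊆ I
    ⁅i⁆⊆I i′∈⁅i⁆ = subst (_∈ I) (≡.sym (x∈⁅y⁆⇒x≡y i i′∈⁅i⁆)) i∈I
    vacuous : DeepBelow R (⋃[ L ] ⁅ i ⁆) (⋃[ L ] (I ─ ⁅ i ⁆))
    vacuous ℕ.zero    _         _ _ _   _   (() , _)
    vacuous (ℕ.suc _) ℕ.zero    _ _ _   _   (_ , () , _)
    vacuous (ℕ.suc _) (ℕ.suc _) S T S⊆ T⊆ _ with S⊆ zero | T⊆ zero
    ... | i′ , i′∈I─i , s∈ | i″ , i″∈⁅i⁆ , t∈ =
      ⊥-elim (x∈p─q⇒x∉q I ⁅ i ⁆ i′∈I─i (subst (_∈ ⁅ i ⁆) (≡.sym i′≡i″) i″∈⁅i⁆))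
      where
      i′≡i″ : i′ ≡ i″
      i′≡i″ = residue-unique L i′ i″ (π₁-const _ _ (proj₁ s∈) (proj₁ t∈)) s∈ t∈

  Splittable-reindex : ∀ {d q r} {L L′ : LevelledSet d} (t : Fin q → Fin r) → (∀ {i j} → t i ≡ t j → i ≡ j) →
                       (∀ i → points (L′ [ + toℕ i mod q ]) ⊆′ points (L [ + toℕ (t i) mod r ])) →
                       Splittable r L → Splittable q L′
  Splittable-reindex {L = L} {L′} t t-injective piece⊆ split I 2≤∣I∣ with 2≤∣p∣⇒∈∧∈∧≢ I 2≤∣I∣
  ... | i , j , i∈I , j∈I , i≢j
    with split (image t I) (∈∧∈∧≢⇒2≤∣p∣ (∈-image⁺ t I i∈I) (∈-image⁺ t I j∈I) (i≢j ∘ t-injective))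
  ... | J′ , J′⊆tI , (k , k∈J′) , (k′ , k′∈tI─J′) , below =
    J , p∩q⊆p I _ , J≢∅ , I─J≢∅ , DeepBelow-anti ⋃J⊆ ⋃I─J⊆ below
    where
    J = I ∩ preimage t J′
    ∈J⁺ : ∀ {i} → i ∈ I → t i ∈ J′ → i ∈ J
    ∈J⁺ i∈I ti∈J′ = x∈p∩q⁺ (i∈I , ∈-filter⁺ (λ i → t i ∈? J′) ti∈J′)
    ∈J⁻ : ∀ {i} → i ∈ J → t i ∈ J′
    ∈J⁻ i∈J = ∈-filter⁻ (λ i → t i ∈? J′) (proj₂ (x∈p∩q⁻ I _ i∈J))
    J≢∅ : Nonempty J
    J≢∅ with ∈-image⁻ t I (J′⊆tI k∈J′)
    ... | i′ , i′∈I , ≡.refl = i′ , ∈J⁺ i′∈I k∈J′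
    I─J≢∅ : Nonempty (I ─ J)
    I─J≢∅ with ∈-image⁻ t I (p─q⊆p (image t I) J′ k′∈tI─J′)
    ... | i′ , i′∈I , ≡.refl = i′ , x∈p∧x∉q⇒x∈p─q i′∈I (x∈p─q⇒x∉q (image t I) J′ k′∈tI─J′ ∘ ∈J⁻)
    ⋃J⊆ : ⋃[ L′ ] J ⊆′ ⋃[ L ] J′
    ⋃J⊆ x (i′ , i′∈J , x∈) = t i′ , ∈J⁻ i′∈J , piece⊆ i′ x x∈
    ⋃I─J⊆ : ⋃[ L′ ] (I ─ J) ⊆′ ⋃[ L ] (image t I ─ J′)
    ⋃I─J⊆ x (i′ , i′∈I─J , x∈) =
      t i′ , x∈p∧x∉q⇒x∈p─q (∈-image⁺ t I i′∈I) (x∈p─q⇒x∉q I J i′∈I─J ∘ ∈J⁺ i′∈I) , piece⊆ i′ x x∈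
      where
      i′∈I = p─q⊆p I J i′∈I─J

  [mod]-swap : ∀ {d} (L : LevelledSet d) c i {q P j w} → 1 ≤ q → 1 ≤ P →
               c ℤ.+ + q ℤ.* i ≡ j ℤ.+ + P ℤ.* w → L [ c mod q ] [ i mod P ] ≋ L [ j mod P ] [ w mod q ]
  [mod]-swap L c i {q} {P} {j} {w} 1≤q 1≤P eq =
    ≋-trans ([mod]-∘ L c i 1≤q 1≤P) (≋-trans ([mod]-cong eq (ℕ.*-comm q P)) (≋-sym ([mod]-∘ L j w 1≤P 1≤q)))

  Splittable-[mod] : ∀ {d P q} (L : LevelledSet d) c → Prime P → ¬ P ℕ.∣ q → 1 ≤ q →
                     Splittable P L → Splittable P (L [ c mod q ])
  Splittable-[mod] {P = P} {q} L c P-prime P∤q 1≤q = Splittable-reindex t t-injective piece⊆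
    where
    instance
      P≢0 : ℕ.NonZero P
      P≢0 = prime⇒nonZero P-prime
    e : Fin P → ℤ
    e i = c ℤ.+ + q ℤ.* + toℕ i
    t : Fin P → Fin P
    t i = residue (e i) P
    t-injective : ∀ {i j} → t i ≡ t j → i ≡ j
    t-injective {i} {j} ti≡tj = affine-residues-injective P-prime P∤q {c} i j (residue-quotient (e i) P)
      (subst (λ r → e j ≡ + toℕ r ℤ.+ + P ℤ.* (e j ℤ./ℕ P)) (≡.sym ti≡tj) (residue-quotient (e j) P))
    piece⊆ : ∀ i → points (L [ c mod q ] [ + toℕ i mod P ]) ⊆′ points (L [ + toℕ (t i) mod P ])
    piece⊆ i = ⊆′-trans (⊑⇒⊆ (proj₁ ([mod]-∘ L c (+ toℕ i) 1≤q (ℕ.>-nonZero⁻¹ P))))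
                 (⊆′-trans (⊑⇒⊆ (proj₁ ([mod]-cong (residue-quotient (e i) P) ≡.refl))) ([mod]-⊆ L (ℕ.n∣m*n q)))

  Horton⇒Splittable : ∀ {p k d} {L : LevelledSet (suc d)} → k ≤ d → Horton p k L →
                      Splittable (p (suc (suc d))) L
  Horton⇒Splittable k≤d (rule1 _ _)           = ⊥-elim (ℕ.n≮n _ k≤d)
  Horton⇒Splittable _   (rule2 _ _ π₁-const)  = π₁-constant⇒Splittable _ π₁-const
  Horton⇒Splittable _   (rule3 _ _ _ _ split) = split

  module _ {p : ℕ → ℕ} (p-prime : ∀ i → 2 ≤ i → Prime (p i)) where

    Horton-[mod] : ∀ {k d} {L : LevelledSet d} → Horton p k L → ∀ c {q} → 1 ≤ q → Horton p k (L [ c mod q ])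
    Horton-[mod] (rule1 k≤k base) c 1≤q = rule1 k≤k (Base-[mod] c 1≤q base)
    Horton-[mod] (rule2 k≤d base π₁-const) c 1≤q =
      rule2 k≤d (Base-[mod] c 1≤q base) (λ x y x∈ y∈ → π₁-const x y (proj₁ x∈) (proj₁ y∈))
    Horton-[mod] {k} {ℕ.suc d} {L} (rule3 k≤d base proj-H sub-H split) c {q} 1≤q =
      rule3 k≤d (Base-[mod] c 1≤q base)
        (Horton-resp (≋-sym (project-[mod] L c q)) (Horton-[mod] proj-H c 1≤q))
        sublevel
        splitting
      where
      P = p (suc (suc d))
      P-prime : Prime P
      P-prime = p-prime (suc (suc d)) (ℕ.s≤s (ℕ.s≤s ℕ.z≤n))
      instance
        P≢0 : ℕ.NonZero P
        P≢0 = prime⇒nonZero P-prime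
      1≤P : 1 ≤ P
      1≤P = ℕ.>-nonZero⁻¹ P

      sublevel : ∀ (i : Fin P) → Horton p k (L [ c mod q ] [ + toℕ i mod P ])
      sublevel i = Horton-resp (≋-sym ([mod]-swap L c (+ toℕ i) 1≤q 1≤P (residue-quotient e P)))
                              (Horton-[mod] (sub-H (residue e P)) (e ℤ./ℕ P) 1≤q)
        where
        e : ℤ
        e = c ℤ.+ + q ℤ.* + toℕ i

      splitting : Splittable P (L [ c mod q ])
      splitting with P ℕ.∣? q
      ... | no P∤q = Splittable-[mod] L c P-prime P∤q 1≤q split
      ... | yes (ℕ.divides q′ q≡q′P) =
        Splittable-anti L[c]⊑L[j][w] (Horton⇒Splittable k≤d (Horton-[mod] (sub-H j) w 1≤q′))
        where
        j : Fin P
        j = residue c P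
        w : ℤ
        w = c ℤ./ℕ P
        1≤q′ : 1 ≤ q′
        1≤q′ = ℕ.n≢0⇒n>0 λ { ≡.refl → ℕ.<⇒≢ 1≤q (≡.sym q≡q′P) }
        L[c]⊑L[j][w] : L [ c mod q ] ⊑ L [ + toℕ j mod P ] [ w mod q′ ]
        L[c]⊑L[j][w] = proj₁ (≋-trans ([mod]-cong (residue-quotient c P) (≡.trans q≡q′P (ℕ.*-comm q′ P)))
                                        (≋-sym ([mod]-∘ L (+ toℕ j) w 1≤P 1≤q′)))

lemma3p13 : (R : RealField) (p : ℕ → ℕ) → (∀ i → 2 ≤ i → Prime (p i)) →
            (k d : ℕ) → k ≤ d →
            (a b : RealField.Carrier R) (H : PSet R (suc d)) →
            HortonSet R p k d a b H →
            (c : ℤ) (q : ℕ) → 1 ≤ q →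
            HortonSet R p k d (subA R a q) (subB R b c q) (Sublevel R a b c q H)
lemma3p13 R p p-prime k d _ a b H H-Horton c q 1≤q = Horton-[mod] R p-prime H-Horton c 1≤q
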